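{- Let $n\ge1$. Let $\{H_1,H_2\}$ be a Latin Hamilton decomposition of $G_{n,2}$ and $\{E_1,\dots,E_n\}$ a Latin Hamilton decomposition of $Q_{2n}$. Then the Hamilton decomposition $\{f(E_i,H_j): 1\le i\le n,\ 1\le j\le 2\}$ of $Q_{4n}$ is Latin.
   Context: $G_{n,k}$ is the Cartesian product of $k$ copies of $C_{4^n}$: vertices $(x_1,\dots,x_k)$, $x_i\in\mathbb{Z}/4^n\mathbb{Z}$, adjacent iff they differ in one coordinate by $\pm1$. $Q_{2m}$ is identified with $G_{1,m}$ (quaternary strings of length $m$, axes $1,\dots,m$). Edges in coordinate $i$ traversed from $x_i$ to $x_i+1$ are labelled $i$, the reverse $\overline i$. Directed Hamilton cycles start and end at the origin $\mathbf 0$ and are recorded as label sequences. A Hamilton decomposition (H.D.) of $G_{n,k}$ is a set of $k$ directed Hamilton cycles whose edge sets partition the edges. A permutation $\sigma$ of $\{1,\dots,k\}$ acts by $(x_1,\dots,x_k)\mapsto(x_{\sigma^{ -1}(1)},\dots,x_{\sigma^{ -1}(k)})$, sending a directed cycle $e_1\cdots e_N$ to $\sigma(e_1)\cdots\sigma(e_N)$ with $\sigma(\overline i)=\overline{\sigma(i)}$. A Latin family is $\{\sigma_1,\dots,\sigma_k\}$ with $\sigma_1=\mathrm{id}$ and $(\sigma_i(j))$ a Latin square; an H.D. $T$ is Latin if $T=\{\sigma_1(H),\dots,\sigma_k(H)\}$ for some directed Hamilton cycle $H$ and Latin family. Definition of $f$: for a directed Hamilton cycle $E$ of $Q_{2n}$,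 let $\varphi_E(u)=t$ if $u$ is the $t$-th vertex of $E$ (the origin being the $0$-th), a bijection $V(Q_{2n})\to\mathbb{Z}/4^n\mathbb{Z}$. Identify $Q_{4n}=Q_{2n}\Box Q_{2n}$, a vertex $(u,v)$ having $u$ on axes $1,\dots,n$ and $v$ on axes $n+1,\dots,2n$. The map $(u,v)\mapsto(\varphi_E(u),\varphi_E(v))$ is a bijection onto $V(G_{n,2})$ fixing the origin under which every edge of $G_{n,2}$ pulls back to an edge of $Q_{4n}$; for a directed Hamilton cycle $H$ of $G_{n,2}$, $f(E,H)$ is the directed Hamilton cycle of $Q_{4n}$ that is the preimage of $H$. -}

module Defs where

open import Data.Nat as ℕ using (ℕ; zero; suc; _^_; _+_; _∸_; NonZero)
open import Data.Nat.DivMod using (_%_; m%n<n)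
open import Data.Nat.Properties using (m^n≢0)
open import Data.Fin as F using (Fin; toℕ; fromℕ<; splitAt)
open import Data.Fin.Properties renaming (_≟_ to _≟F_)
open import Data.Fin.Permutation using (Permutation′; _⟨$⟩ʳ_)
open import Data.Vec as V using (Vec; replicate; updateAt)
open import Data.Vec.Properties using (≡-dec)
open import Data.List as L using (List; _∷_; []; take; mapMaybe; map; allFin; filter; head; _++_)
open import Data.List.Membership.Propositional using (_∈_)
open import Data.List.Relation.Unary.Unique.Propositional using (Unique)
open import Data.Maybe using (Maybe)
open import Data.Product using (Σ; ∃; _×_; _,_; uncurry)
open import Data.Sum using ([_,_])
open import Relation.Binary.PropositionalEquality using (_≡_; refl)
open import Relation.Nullary using (yes; no)
open import Relation.Binary.Definitions using (DecidableEquality)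
open import Function.Definitions using (Injective)

modN : ∀ n → ℕ → Fin (4 ^ n)
modN n x = fromℕ< (m%n<n x (4 ^ n) {{m^n≢0 4 n}})

incZ : ∀ n → Fin (4 ^ n) → Fin (4 ^ n)
incZ n i = modN n (suc (toℕ i))

decZ : ∀ n → Fin (4 ^ n) → Fin (4 ^ n)
decZ n i = modN n (toℕ i + (4 ^ n ∸ 1))

-- G_{n,k} : Cartesian product of k copies of C_{4^n}

record Vertex (n k : ℕ) : Set where
  constructor vtx
  field coords : Vec (Fin (4 ^ n)) k
open Vertex public

_≟V_ : ∀ {n k} → DecidableEquality (Vertex n k)
vtx x ≟V vtx y with ≡-dec _≟F_ x y
... | yes refl = yes refl
... | no x≢y   = no λ { refl → x≢y refl }

origin : ∀ n k → Vertex n k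
origin n k = vtx (replicate k (modN n 0))

-- edge labels: fwd i = "i" (x_i ↦ x_i + 1), bwd i = "ī" (x_i ↦ x_i - 1)
data Label (k : ℕ) : Set where
  fwd bwd : Fin k → Label k

-- a directed cycle / walk from the origin, recorded as its label sequence
Cycle : ℕ → Set
Cycle k = List (Label k)

step : ∀ {n k} → Vertex n k → Label k → Vertex n k
step {n} (vtx x) (fwd i) = vtx (updateAt x i (incZ n))
step {n} (vtx x) (bwd i) = vtx (updateAt x i (decZ n))

verts : ∀ {n k} → Vertex n k → Cycle k → List (Vertex n k)
verts x []       = []
verts x (l ∷ ls) = x ∷ verts (step x l) ls

trail : ∀ {n k} → Vertex n k → Cycle k → List (Vertex n k)
trail x []       = x ∷ []
trail x (l ∷ ls) = x ∷ trail (step x l) ls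

walkEnd : ∀ {n k} → Vertex n k → Cycle k → Vertex n k
walkEnd x []       = x
walkEnd x (l ∷ ls) = walkEnd (step x l) ls

IsHamCycle : ∀ n k → Cycle k → Set
IsHamCycle n k C =
  (walkEnd (origin n k) C ≡ origin n k)
  × Unique (verts (origin n k) C)
  × (∀ (v : Vertex n k) → v ∈ verts (origin n k) C)

-- undirected edges: (v , i) stands for the edge {v , v + e_i}
Edge : ℕ → ℕ → Set
Edge n k = Vertex n k × Fin k

edgeOf : ∀ {n k} → Vertex n k → Label k → Edge n k
edgeOf x (fwd i) = x , i
edgeOf x (bwd i) = step x (bwd i) , i

edgesFrom : ∀ {n k} → Vertex n k → Cycle k → List (Edge n k)
edgesFrom x []       = []
edgesFrom x (l ∷ ls) = edgeOf x l ∷ edgesFrom (step x l) ls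

edges : ∀ n k → Cycle k → List (Edge n k)
edges n k C = edgesFrom (origin n k) C

IsHD : ∀ n k → (Fin k → Cycle k) → Set
IsHD n k T =
  (∀ a → IsHamCycle n k (T a))
  × (∀ (e : Edge n k) →
       Σ (Fin k) λ a → (e ∈ edges n k (T a)) × (∀ b → e ∈ edges n k (T b) → b ≡ a))

actL : ∀ {k} → Permutation′ k → Label k → Label k
actL σ (fwd i) = fwd (σ ⟨$⟩ʳ i)
actL σ (bwd i) = bwd (σ ⟨$⟩ʳ i)

act : ∀ {k} → Permutation′ k → Cycle k → Cycle k
act σ = map (actL σ)

-- Latin family {σ_1, ..., σ_k}: one member is the identity, and the
-- array (σ_i(j)) is a Latin square (rows are permutations by construction;
-- every column contains every symbol exactly once).
IsLatinFamily : ∀ k → (Fin k → Permutation′ k) → Set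
IsLatinFamily k σ =
  (Σ (Fin k) λ i₀ → ∀ j → σ i₀ ⟨$⟩ʳ j ≡ j)
  × (∀ j → Injective _≡_ _≡_ (λ i → σ i ⟨$⟩ʳ j))
  × (∀ j s → Σ (Fin k) λ i → σ i ⟨$⟩ʳ j ≡ s)

-- T is Latin: as a set, T = {σ_1(H), ..., σ_k(H)}
IsLatin : ∀ n k → (Fin k → Cycle k) → Set
IsLatin n k T =
  Σ (Cycle k) λ H → IsHamCycle n k H ×
  Σ (Fin k → Permutation′ k) λ σ → IsLatinFamily k σ ×
    (∀ a → Σ (Fin k) λ i → T a ≡ act (σ i) H) ×
    (∀ i → Σ (Fin k) λ a → act (σ i) H ≡ T a)

IsLatinHD : ∀ n k → (Fin k → Cycle k) → Set
IsLatinHD n k T = IsHD n k T × IsLatin n k T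

-- The map f.  Q_{2m} = G_{1,m}.

-- φ_E^{-1}(t) : the t-th vertex of E (origin = 0-th)
vertexAt : ∀ {n} → Cycle n → ℕ → Vertex 1 n
vertexAt {n} E t = walkEnd (origin 1 n) (take t E)

-- inverse of (u , v) ↦ (φ_E(u) , φ_E(v)),  V(G_{n,2}) → V(Q_{4n}),
-- u on axes 1..n, v on axes n+1..2n
ψinv : ∀ {n} → Cycle n → Vertex n 2 → Vertex 1 (n + n)
ψinv E (vtx (a V.∷ b V.∷ V.[])) = vtx (coords (vertexAt E (toℕ a)) V.++ coords (vertexAt E (toℕ b)))

allLabels : ∀ k → List (Label k)
allLabels k = map fwd (allFin k) ++ map bwd (allFin k)

labelBetween : ∀ {m} → Vertex 1 m → Vertex 1 m → Maybe (Label m)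
labelBetween {m} w w' = head (filter (λ l → step w l ≟V w') (allLabels m))

pairs : ∀ {A : Set} → List A → List (A × A)
pairs (x ∷ y ∷ r) = (x , y) ∷ pairs (y ∷ r)
pairs _           = []

-- f(E,H): the directed Hamilton cycle of Q_{4n} whose vertex sequence is
-- the preimage of the vertex sequence of H
f : ∀ {n} → Cycle n → Cycle 2 → Cycle (n + n)
f {n} E H = mapMaybe (uncurry labelBetween) (pairs (map (ψinv E) (trail (origin n 2) H)))

-- the family {f(E_i,H_j)} indexed by Fin (n + n) ≅ Fin n ⊎ Fin n
-- (first block j = 1, second block j = 2)
fFamily : ∀ {n} → (Fin n → Cycle n) → (Fin 2 → Cycle 2) → Fin (n + n) → Cycle (n + n)
fFamily {n} E H a = [ (λ i → f (E i) (H F.zero)) , (λ i → f (E i) (H (F.suc F.zero))) ] (splitAt n a)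

-- Let ψ_E be the inverse of (u, v) ↦ (φ_E(u), φ_E(v)). Consecutive vertices of E are adjacent,
-- so ψ_E carries every step of a walk in G_{n,2} to a step of Q_{4n} inside one of its two copies
-- of Q_{2n}: f(E, H) is the step-by-step lift of H, a Hamilton cycle whose edges are the images of
-- those of H. An edge of Q_{4n} projects, inside its copy of Q_{2n}, to an edge lying in exactly one
-- E_i; since 4^n > 2, E_i passes that edge at a single position, so the edge comes from exactly one
-- edge of G_{n,2}, which lies in exactly one H_j. Hence the f(E_i, H_j) decompose Q_{4n}. Finally,
-- permuting axes commutes with f: f(τE, πH) = (π ⊗ τ) f(E, H), where π ⊗ τ permutes the two copies
-- by π and the axes inside each copy by τ, and the products π_j ⊗ τ_i of two Latin families again
-- form a Latin family.

module Submission where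

open import Defs
open import Data.Nat as ℕ using (ℕ; zero; suc; _≤_; _<_; _+_; _*_; _^_; _∸_; z≤n; s≤s; NonZero)
import Data.Nat.Properties as ℕₚ
open import Data.Nat.DivMod
open import Data.Nat.Divisibility using (_∣_; divides; ∣⇒≤)
open import Data.Fin as Fin using (Fin; toℕ; cast; splitAt; _↑ˡ_; _↑ʳ_)
import Data.Fin.Properties as Finₚ
open import Data.Fin.Permutation using (Permutation′; _⟨$⟩ʳ_; _⟨$⟩ˡ_; permutation; inverseˡ; inverseʳ)
open import Data.Vec as V using (Vec; updateAt)
import Data.Vec.Properties as Vₚ
open import Data.List as L using (List; []; _∷_; length; take; map; filter; head; allFin)
import Data.List.Properties as Lₚ
open import Data.List.Membership.Propositional using (_∈_)
import Data.List.Membership.Propositional.Properties as ∈ₚ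
open import Data.List.Relation.Unary.Any using (here; there)
import Data.List.Relation.Unary.All as All
open import Data.List.Relation.Unary.AllPairs using (_∷_)
open import Data.List.Relation.Unary.Unique.Propositional using (Unique)
import Data.List.Relation.Unary.Unique.Propositional.Properties as Uniqueₚ
open import Data.Maybe using (just)
open import Data.Product as Product using (Σ; _×_; _,_; proj₁; proj₂; uncurry)
open import Data.Sum using (_⊎_; inj₁; inj₂; [_,_])
open import Data.Empty using (⊥; ⊥-elim)
open import Function using (_∘_; _$_; Injective; _↔_; Inverse; mk↔ₛ′)
open import Relation.Binary.PropositionalEquality hiding ([_])
open import Relation.Nullary using (yes; no)
open import Relation.Unary using (Decidable)

tabulate-unique⇒injective : ∀ {A : Set} {m} {f : Fin m → A} → Unique (L.tabulate f) → Injective _≡_ _≡_ f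
tabulate-unique⇒injective {m = suc m} _          {Fin.zero}  {Fin.zero}  eq = refl
tabulate-unique⇒injective {m = suc m} (f0∉ ∷ _) {Fin.zero}  {Fin.suc j} eq = ⊥-elim (All.lookup f0∉ (∈ₚ.∈-tabulate⁺ j) eq)
tabulate-unique⇒injective {m = suc m} (f0∉ ∷ _) {Fin.suc i} {Fin.zero}  eq = ⊥-elim (All.lookup f0∉ (∈ₚ.∈-tabulate⁺ i) (sym eq))
tabulate-unique⇒injective {m = suc m} (_ ∷ u)   {Fin.suc i} {Fin.suc j} eq = cong Fin.suc (tabulate-unique⇒injective u eq)

enumeration-length : ∀ {A : Set} {m N} → A ↔ Fin N → (f : Fin m → A) →
  Unique (L.tabulate f) → (∀ a → a ∈ L.tabulate f) → m ≡ N
enumeration-length {A} {m} A↔Fin f unique complete =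
  Finₚ.cantor-schröder-bernstein {f = to ∘ f} {g = index ∘ from} to∘f-injective index∘from-injective
  where
  open Inverse A↔Fin
  index : A → Fin m
  index a = proj₁ (∈ₚ.∈-tabulate⁻ (complete a))
  to-injective : Injective _≡_ _≡_ to
  to-injective {a} {b} eq = trans (sym (strictlyInverseʳ a)) (trans (cong from eq) (strictlyInverseʳ b))
  to∘f-injective : Injective _≡_ _≡_ (to ∘ f)
  to∘f-injective = tabulate-unique⇒injective unique ∘ to-injective
  index∘from-injective : Injective _≡_ _≡_ (index ∘ from)
  index∘from-injective {i} {j} eq = begin
    i                ≡⟨ strictlyInverseˡ i ⟨
    to (from i)      ≡⟨ cong to (proj₂ (∈ₚ.∈-tabulate⁻ (complete (from i)))) ⟩
    to (f (index (from i))) ≡⟨ cong (to ∘ f) eq ⟩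
    to (f (index (from j))) ≡⟨ cong to (proj₂ (∈ₚ.∈-tabulate⁻ (complete (from j)))) ⟨
    to (from j)      ≡⟨ strictlyInverseˡ j ⟩
    j                ∎
    where open ≡-Reasoning

[1+m%n]%n≡[1+m]%n : ∀ m n .{{_ : NonZero n}} → suc (m % n) % n ≡ suc m % n
[1+m%n]%n≡[1+m]%n m n = begin
  (1 + m % n) % n           ≡⟨ %-distribˡ-+ 1 (m % n) n ⟩
  (1 % n + m % n % n) % n   ≡⟨ cong (λ r → (1 % n + r) % n) (m%n%n≡m%n m n) ⟩
  (1 % n + m % n) % n       ≡⟨ %-distribˡ-+ 1 m n ⟨
  (1 + m) % n               ∎
  where open ≡-Reasoning

[k+m]%n≡m⇒n∣k : ∀ k m n .{{_ : NonZero n}} → (k + m) % n ≡ m → n ∣ k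
[k+m]%n≡m⇒n∣k k m n eq = divides ((k + m) / n) (ℕₚ.+-cancelʳ-≡ m k _ (begin
  k + m                          ≡⟨ m≡m%n+[m/n]*n (k + m) n ⟩
  (k + m) % n + (k + m) / n * n  ≡⟨ cong (_+ (k + m) / n * n) eq ⟩
  m + (k + m) / n * n            ≡⟨ ℕₚ.+-comm m _ ⟩
  (k + m) / n * n + m            ∎))
  where open ≡-Reasoning

module _ (n : ℕ) where

  private
    N : ℕ
    N = 4 ^ n

    instance
      N≢0 : NonZero N
      N≢0 = ℕₚ.m^n≢0 4 n

  toℕ-modN : ∀ x → toℕ (modN n x) ≡ x % N
  toℕ-modN x = Finₚ.toℕ-fromℕ< _

  toℕ-incZ : ∀ a → toℕ (incZ n a) ≡ suc (toℕ a) % N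
  toℕ-incZ a = toℕ-modN (suc (toℕ a))

  toℕ-modN-0 : toℕ (modN n 0) ≡ 0
  toℕ-modN-0 = trans (toℕ-modN 0) (m<n⇒m%n≡m (ℕₚ.m^n>0 4 n))

  incZ-decZ : ∀ a → incZ n (decZ n a) ≡ a
  incZ-decZ a = Finₚ.toℕ-injective (begin
    toℕ (incZ n (decZ n a))          ≡⟨ toℕ-incZ (decZ n a) ⟩
    suc (toℕ (decZ n a)) % N         ≡⟨ cong (λ r → suc r % N) (toℕ-modN _) ⟩
    suc ((toℕ a + (N ∸ 1)) % N) % N  ≡⟨ [1+m%n]%n≡[1+m]%n (toℕ a + (N ∸ 1)) N ⟩
    suc (toℕ a + (N ∸ 1)) % N        ≡⟨ cong (_% N) (ℕₚ.+-suc (toℕ a) (N ∸ 1)) ⟨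
    (toℕ a + suc (N ∸ 1)) % N        ≡⟨ cong (λ r → (toℕ a + r) % N) (ℕₚ.suc-pred N) ⟩
    (toℕ a + N) % N                  ≡⟨ [m+n]%n≡m%n (toℕ a) N ⟩
    toℕ a % N                        ≡⟨ m<n⇒m%n≡m (Finₚ.toℕ<n a) ⟩
    toℕ a                            ∎)
    where open ≡-Reasoning

  -- 4 ^ n does not divide 2.
  incZ-incZ≢id : 1 ≤ n → ∀ a → incZ n (incZ n a) ≢ a
  incZ-incZ≢id 1≤n a eq = ℕₚ.<⇒≱ (N>2 1≤n) (∣⇒≤ ([k+m]%n≡m⇒n∣k 2 (toℕ a) N (begin
    (2 + toℕ a) % N                 ≡⟨ [1+m%n]%n≡[1+m]%n (suc (toℕ a)) N ⟨
    suc (suc (toℕ a) % N) % N       ≡⟨ cong (λ r → suc r % N) (toℕ-incZ a) ⟨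
    suc (toℕ (incZ n a)) % N        ≡⟨ toℕ-incZ (incZ n a) ⟨
    toℕ (incZ n (incZ n a))         ≡⟨ cong toℕ eq ⟩
    toℕ a                           ∎)))
    where
    open ≡-Reasoning
    N>2 : 1 ≤ n → 2 < N
    N>2 (s≤s {n = n'} _) = ℕₚ.≤-trans (s≤s (s≤s (s≤s z≤n))) (ℕₚ.m≤m*n 4 (4 ^ n') {{ℕₚ.m^n≢0 4 n'}})

  toℕ-incZ-cases : ∀ a → toℕ (incZ n a) ≡ suc (toℕ a) ⊎ (toℕ (incZ n a) ≡ 0 × suc (toℕ a) ≡ N)
  toℕ-incZ-cases a with suc (toℕ a) ℕₚ.<? N
  ... | yes 1+a<N = inj₁ (trans (toℕ-incZ a) (m<n⇒m%n≡m 1+a<N))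
  ... | no 1+a≮N  = inj₂ (trans (toℕ-incZ a) (trans (cong (_% N) 1+a≡N) (n%n≡0 N)) , 1+a≡N)
    where
    1+a≡N : suc (toℕ a) ≡ N
    1+a≡N = ℕₚ.≤-antisym (Finₚ.toℕ<n a) (ℕₚ.≮⇒≥ 1+a≮N)

module _ {n k : ℕ} where

  verts≡tabulate : (x : Vertex n k) (C : Cycle k) →
    verts x C ≡ L.tabulate (λ (t : Fin (length C)) → walkEnd x (take (toℕ t) C))
  verts≡tabulate x []      = refl
  verts≡tabulate x (l ∷ C) = cong (x ∷_) (verts≡tabulate (step x l) C)

  edgesFrom≡tabulate : (x : Vertex n k) (C : Cycle k) →
    edgesFrom x C ≡ L.tabulate (λ (t : Fin (length C)) → edgeOf (walkEnd x (take (toℕ t) C)) (L.lookup C t))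
  edgesFrom≡tabulate x []      = refl
  edgesFrom≡tabulate x (l ∷ C) = cong (edgeOf x l ∷_) (edgesFrom≡tabulate (step x l) C)

  walkEnd-take-suc : (x : Vertex n k) (C : Cycle k) (t : Fin (length C)) →
    walkEnd x (take (suc (toℕ t)) C) ≡ step (walkEnd x (take (toℕ t) C)) (L.lookup C t)
  walkEnd-take-suc x (l ∷ C) Fin.zero    = refl
  walkEnd-take-suc x (l ∷ C) (Fin.suc t) = walkEnd-take-suc (step x l) C t

axis : ∀ {k} → Label k → Fin k
axis (fwd i) = i
axis (bwd i) = i

move : ∀ n {k} → Label k → Fin (4 ^ n) → Fin (4 ^ n)
move n (fwd _) = incZ n
move n (bwd _) = decZ n

opposite : ∀ {k} → Label k → Label k
opposite (fwd i) = bwd i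
opposite (bwd i) = fwd i

coord : ∀ {n k} → Vertex n k → Fin k → Fin (4 ^ n)
coord w i = V.lookup (coords w) i

coords-step : ∀ {n k} (w : Vertex n k) (l : Label k) →
  coords (step w l) ≡ updateAt (coords w) (axis l) (move n l)
coords-step (vtx x) (fwd i) = refl
coords-step (vtx x) (bwd i) = refl

coord-step-axis : ∀ {n k} (w : Vertex n k) (l : Label k) →
  coord (step w l) (axis l) ≡ move n l (coord w (axis l))
coord-step-axis w l = trans (cong (λ x → V.lookup x (axis l)) (coords-step w l)) (Vₚ.lookup∘updateAt (axis l) (coords w))

coord-step-other : ∀ {n k} (w : Vertex n k) (l : Label k) {j} → j ≢ axis l → coord (step w l) j ≡ coord w j
coord-step-other w l {j} j≢i =
  trans (cong (λ x → V.lookup x j) (coords-step w l)) (Vₚ.lookup∘updateAt′ j (axis l) j≢i (coords w))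

decZ-incZ-1 : ∀ a → decZ 1 (incZ 1 a) ≡ a
decZ-incZ-1 Fin.zero                                = refl
decZ-incZ-1 (Fin.suc Fin.zero)                      = refl
decZ-incZ-1 (Fin.suc (Fin.suc Fin.zero))            = refl
decZ-incZ-1 (Fin.suc (Fin.suc (Fin.suc Fin.zero)))  = refl

incZ-1≢id : ∀ a → incZ 1 a ≢ a
incZ-1≢id Fin.zero                               ()
incZ-1≢id (Fin.suc Fin.zero)                     ()
incZ-1≢id (Fin.suc (Fin.suc Fin.zero))           ()
incZ-1≢id (Fin.suc (Fin.suc (Fin.suc Fin.zero))) ()

move-1≢id : ∀ {k} (l : Label k) a → move 1 l a ≢ a
move-1≢id (fwd _) a = incZ-1≢id a
move-1≢id (bwd _) a eq = incZ-1≢id a (trans (cong (incZ 1) (sym eq)) (incZ-decZ 1 a))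

incZ-1≢decZ-1 : ∀ a → incZ 1 a ≢ decZ 1 a
incZ-1≢decZ-1 a eq = incZ-incZ≢id 1 (s≤s z≤n) a (trans (cong (incZ 1) eq) (incZ-decZ 1 a))

axis-move-injective : ∀ {k} (l l' : Label k) → axis l ≡ axis l' → ∀ {a} → move 1 l a ≡ move 1 l' a → l ≡ l'
axis-move-injective (fwd i) (fwd .i) refl     _  = refl
axis-move-injective (bwd i) (bwd .i) refl     _  = refl
axis-move-injective (fwd i) (bwd .i) refl {a} eq = ⊥-elim (incZ-1≢decZ-1 a eq)
axis-move-injective (bwd i) (fwd .i) refl {a} eq = ⊥-elim (incZ-1≢decZ-1 a (sym eq))

module _ {k : ℕ} where

  step-opposite : (w : Vertex 1 k) (l : Label k) → step (step w l) (opposite l) ≡ w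
  step-opposite (vtx x) (fwd i) =
    cong vtx (trans (Vₚ.updateAt-updateAt i x) (Vₚ.updateAt-id-local i x (decZ-incZ-1 _)))
  step-opposite (vtx x) (bwd i) =
    cong vtx (trans (Vₚ.updateAt-updateAt i x) (Vₚ.updateAt-id-local i x (incZ-decZ 1 _)))

  step-injective : ∀ {w w' : Vertex 1 k} (l : Label k) → step w l ≡ step w' l → w ≡ w'
  step-injective {w} {w'} l eq = begin
    w                               ≡⟨ step-opposite w l ⟨
    step (step w l) (opposite l)    ≡⟨ cong (λ v → step v (opposite l)) eq ⟩
    step (step w' l) (opposite l)   ≡⟨ step-opposite w' l ⟩
    w'                              ∎
    where open ≡-Reasoning

  step-injectiveʳ : (w : Vertex 1 k) {l l' : Label k} → step w l ≡ step w l' → l ≡ l'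
  step-injectiveʳ w {l} {l'} eq with axis l Finₚ.≟ axis l'
  ... | no i≢i' = ⊥-elim (move-1≢id l _ (begin
    move 1 l (coord w (axis l))  ≡⟨ coord-step-axis w l ⟨
    coord (step w l) (axis l)    ≡⟨ cong (λ v → coord v (axis l)) eq ⟩
    coord (step w l') (axis l)   ≡⟨ coord-step-other w l' i≢i' ⟩
    coord w (axis l)             ∎))
    where open ≡-Reasoning
  ... | yes i≡i' = axis-move-injective l l' i≡i' (begin
    move 1 l (coord w (axis l))    ≡⟨ coord-step-axis w l ⟨
    coord (step w l) (axis l)      ≡⟨ cong (λ v → coord v (axis l)) eq ⟩
    coord (step w l') (axis l)     ≡⟨ cong (coord (step w l')) i≡i' ⟩
    coord (step w l') (axis l')    ≡⟨ coord-step-axis w l' ⟩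
    move 1 l' (coord w (axis l'))  ≡⟨ cong (λ i → move 1 l' (coord w i)) i≡i' ⟨
    move 1 l' (coord w (axis l))   ∎)
    where open ≡-Reasoning

  edgeOf-opposite : (w : Vertex 1 k) (l : Label k) → edgeOf (step w l) (opposite l) ≡ edgeOf w l
  edgeOf-opposite w (fwd i) = cong (_, i) (step-opposite w (fwd i))
  edgeOf-opposite w (bwd i) = refl

fromDigits : ∀ {m k} → Vec (Fin m) k → Fin (m ^ k)
fromDigits V.[]       = Fin.zero
fromDigits (d V.∷ ds) = Fin.combine d (fromDigits ds)

toDigits : ∀ {m} k → Fin (m ^ k) → Vec (Fin m) k
toDigits zero    _     = V.[]
toDigits {m} (suc k) i = uncurry (λ d r → d V.∷ toDigits k r) (Fin.remQuot (m ^ k) i)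

toDigits-fromDigits : ∀ {m k} (ds : Vec (Fin m) k) → toDigits k (fromDigits ds) ≡ ds
toDigits-fromDigits V.[] = refl
toDigits-fromDigits {m} {suc k} (d V.∷ ds) = trans
  (cong (uncurry (λ d r → d V.∷ toDigits k r)) (Finₚ.remQuot-combine d (fromDigits ds)))
  (cong (d V.∷_) (toDigits-fromDigits ds))

fromDigits-toDigits : ∀ {m} k (i : Fin (m ^ k)) → fromDigits (toDigits k i) ≡ i
fromDigits-toDigits zero    Fin.zero = refl
fromDigits-toDigits {m} (suc k) i =
  trans (cong (Fin.combine d) (fromDigits-toDigits k r)) (Finₚ.combine-remQuot {m} (m ^ k) i)
  where
  d : Fin m
  d = proj₁ (Fin.remQuot {m} (m ^ k) i)
  r : Fin (m ^ k)
  r = proj₂ (Fin.remQuot {m} (m ^ k) i)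

vertex↔Fin : ∀ k → Vertex 1 k ↔ Fin (4 ^ k)
vertex↔Fin k = mk↔ₛ′ (fromDigits ∘ coords) (vtx ∘ toDigits k)
  (fromDigits-toDigits k) (λ w → cong vtx (toDigits-fromDigits (coords w)))

head-filter-unique : ∀ {A : Set} {P : A → Set} (P? : Decidable P) {xs : List A} {x : A} →
  x ∈ xs → P x → (∀ {y} → P y → y ≡ x) → head (filter P? xs) ≡ just x
head-filter-unique P? {y ∷ ys} (here refl) px unique = cong head (Lₚ.filter-accept P? px)
head-filter-unique P? {y ∷ ys} (there x∈ys) px unique with P? y
... | yes py = cong just (unique py)
... | no _   = head-filter-unique P? x∈ys px unique

∈-allLabels : ∀ {k} (l : Label k) → l ∈ allLabels k
∈-allLabels {k} (fwd i) = ∈ₚ.∈-++⁺ˡ (∈ₚ.∈-map⁺ fwd (∈ₚ.∈-allFin i))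
∈-allLabels {k} (bwd i) = ∈ₚ.∈-++⁺ʳ (map fwd (allFin k)) (∈ₚ.∈-map⁺ bwd (∈ₚ.∈-allFin i))

labelBetween-step : ∀ {k} (w : Vertex 1 k) (l : Label k) → labelBetween w (step w l) ≡ just l
labelBetween-step {k} w l =
  head-filter-unique (λ l' → step w l' ≟V step w l) (∈-allLabels l) refl (step-injectiveʳ w)

-- Q_{2(m+n)} = Q_{2m} □ Q_{2n}

mapAxis : ∀ {k k'} → (Fin k → Fin k') → Label k → Label k'
mapAxis f (fwd i) = fwd (f i)
mapAxis f (bwd i) = bwd (f i)

updateAt-++ˡ : ∀ {A : Set} {m n} (xs : Vec A m) (ys : Vec A n) (i : Fin m) (g : A → A) →
  updateAt (xs V.++ ys) (i ↑ˡ n) g ≡ updateAt xs i g V.++ ys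
updateAt-++ˡ (x V.∷ xs) ys Fin.zero    g = refl
updateAt-++ˡ (x V.∷ xs) ys (Fin.suc i) g = cong (x V.∷_) (updateAt-++ˡ xs ys i g)

updateAt-++ʳ : ∀ {A : Set} {m n} (xs : Vec A m) (ys : Vec A n) (i : Fin n) (g : A → A) →
  updateAt (xs V.++ ys) (m ↑ʳ i) g ≡ xs V.++ updateAt ys i g
updateAt-++ʳ V.[]       ys i g = refl
updateAt-++ʳ (x V.∷ xs) ys i g = cong (x V.∷_) (updateAt-++ʳ xs ys i g)

module _ {r m n : ℕ} where

  _++ᵥ_ : Vertex r m → Vertex r n → Vertex r (m + n)
  u ++ᵥ v = vtx (coords u V.++ coords v)

  ++ᵥ-injective : ∀ {u u' v v'} → u ++ᵥ v ≡ u' ++ᵥ v' → u ≡ u' × v ≡ v'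
  ++ᵥ-injective {u} {u'} eq with Vₚ.++-injective (coords u) (coords u') (cong coords eq)
  ... | refl , refl = refl , refl

  ++ᵥ-surjective : ∀ w → Σ (Vertex r m) λ u → Σ (Vertex r n) λ v → u ++ᵥ v ≡ w
  ++ᵥ-surjective (vtx x) with V.splitAt m x
  ... | xs , ys , refl = vtx xs , vtx ys , refl

  step-++ᵥˡ : ∀ u v (l : Label m) → step (u ++ᵥ v) (mapAxis (_↑ˡ n) l) ≡ step u l ++ᵥ v
  step-++ᵥˡ u v (fwd i) = cong vtx (updateAt-++ˡ (coords u) (coords v) i _)
  step-++ᵥˡ u v (bwd i) = cong vtx (updateAt-++ˡ (coords u) (coords v) i _)

  step-++ᵥʳ : ∀ u v (l : Label n) → step (u ++ᵥ v) (mapAxis (m ↑ʳ_) l) ≡ u ++ᵥ step v l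
  step-++ᵥʳ u v (fwd i) = cong vtx (updateAt-++ʳ (coords u) (coords v) i _)
  step-++ᵥʳ u v (bwd i) = cong vtx (updateAt-++ʳ (coords u) (coords v) i _)

  edgeˡ : Edge r m → Vertex r n → Edge r (m + n)
  edgeˡ (w , i) v = w ++ᵥ v , i ↑ˡ n

  edgeʳ : Vertex r m → Edge r n → Edge r (m + n)
  edgeʳ u (w , i) = u ++ᵥ w , m ↑ʳ i

  edgeOf-++ᵥˡ : ∀ u v (l : Label m) → edgeOf (u ++ᵥ v) (mapAxis (_↑ˡ n) l) ≡ edgeˡ (edgeOf u l) v
  edgeOf-++ᵥˡ u v (fwd i) = refl
  edgeOf-++ᵥˡ u v (bwd i) = cong (_, i ↑ˡ n) (step-++ᵥˡ u v (bwd i))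

  edgeOf-++ᵥʳ : ∀ u v (l : Label n) → edgeOf (u ++ᵥ v) (mapAxis (m ↑ʳ_) l) ≡ edgeʳ u (edgeOf v l)
  edgeOf-++ᵥʳ u v (fwd i) = refl
  edgeOf-++ᵥʳ u v (bwd i) = cong (_, m ↑ʳ i) (step-++ᵥʳ u v (bwd i))

  edgeˡ-injective : ∀ {e e' v v'} → edgeˡ e v ≡ edgeˡ e' v' → e ≡ e' × v ≡ v'
  edgeˡ-injective {w , i} {w' , i'} eq with ++ᵥ-injective {u = w} {w'} (cong proj₁ eq)
  ... | refl , refl = cong (w ,_) (Finₚ.↑ˡ-injective n i i' (cong proj₂ eq)) , refl

  edgeʳ-injective : ∀ {u u' e e'} → edgeʳ u e ≡ edgeʳ u' e' → u ≡ u' × e ≡ e'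
  edgeʳ-injective {u} {u'} {w , i} {w' , i'} eq with ++ᵥ-injective {u = u} {u'} (cong proj₁ eq)
  ... | refl , refl = refl , cong (w ,_) (Finₚ.↑ʳ-injective m i i' (cong proj₂ eq))

  edgeˡ≢edgeʳ : ∀ e v u e' → edgeˡ e v ≢ edgeʳ u e'
  edgeˡ≢edgeʳ (_ , i) _ _ (_ , j) eq
    with () ← trans (sym (Finₚ.splitAt-↑ˡ m i n)) (trans (cong (splitAt m ∘ proj₂) eq) (Finₚ.splitAt-↑ʳ m n j))

  edge-split : (e : Edge r (m + n)) →
    (Σ (Edge r m) λ e' → Σ (Vertex r n) λ v → edgeˡ e' v ≡ e) ⊎ (Σ (Vertex r m) λ u → Σ (Edge r n) λ e' → edgeʳ u e' ≡ e)
  edge-split (w , c) with ++ᵥ-surjective w | splitAt m c in split-c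
  ... | u , v , refl | inj₁ i = inj₁ ((u , i) , v , cong (w ,_) (trans (cong (Fin.join m n) (sym split-c)) (Finₚ.join-splitAt m n c)))
  ... | u , v , refl | inj₂ i = inj₂ (u , (v , i) , cong (w ,_) (trans (cong (Fin.join m n) (sym split-c)) (Finₚ.join-splitAt m n c)))

module _ {r n : ℕ} where

  project : Edge r (n + n) → Edge r n
  project (w , c) = [ (λ i → vtx (V.take n (coords w)) , i) , (λ i → vtx (V.drop n (coords w)) , i) ] (splitAt n c)

  project-edgeˡ : ∀ (e : Edge r n) (v : Vertex r n) → project (edgeˡ e v) ≡ e
  project-edgeˡ (u , i) v rewrite Finₚ.splitAt-↑ˡ n i n =
    cong (λ x → vtx x , i) (proj₁ (Vₚ.++-injective _ _ (Vₚ.take++drop≡id n (coords u V.++ coords v))))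

  project-edgeʳ : ∀ (u : Vertex r n) (e : Edge r n) → project (edgeʳ u e) ≡ e
  project-edgeʳ u (v , i) rewrite Finₚ.splitAt-↑ʳ n n i =
    cong (λ x → vtx x , i) (proj₂ (Vₚ.++-injective _ _ (Vₚ.take++drop≡id n (coords u V.++ coords v))))

-- Hamilton cycles of Q_{2n} as enumerations

module Enumeration {n : ℕ} (E : Cycle n) (hE : IsHamCycle 1 n E) where

  private
    o : Vertex 1 n
    o = origin 1 n

    closed : walkEnd o E ≡ o
    closed = proj₁ hE

    walkPos : Fin (length E) → Vertex 1 n
    walkPos t = walkEnd o (take (toℕ t) E)

    edgePos : Fin (length E) → Edge 1 n
    edgePos t = edgeOf (walkPos t) (L.lookup E t)

    unique-walkPos : Unique (L.tabulate walkPos)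
    unique-walkPos = subst Unique (verts≡tabulate o E) (proj₁ (proj₂ hE))

    walkPos-injective : Injective _≡_ _≡_ walkPos
    walkPos-injective = tabulate-unique⇒injective unique-walkPos

    ∈-walkPos : ∀ v → v ∈ L.tabulate walkPos
    ∈-walkPos v = subst (v ∈_) (verts≡tabulate o E) (proj₂ (proj₂ hE) v)

  length≡4^n : length E ≡ 4 ^ n
  length≡4^n = enumeration-length (vertex↔Fin n) walkPos unique-walkPos ∈-walkPos

  -- at = φ_E⁻¹, and exit a labels the edge of E leaving at a.
  at : Fin (4 ^ n) → Vertex 1 n
  at a = vertexAt E (toℕ a)

  exit : Fin (4 ^ n) → Label n
  exit a = L.lookup E (cast (sym length≡4^n) a)

  edgeAt : Fin (4 ^ n) → Edge 1 n
  edgeAt a = edgeOf (at a) (exit a)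

  private
    at≡walkPos : ∀ a → at a ≡ walkPos (cast (sym length≡4^n) a)
    at≡walkPos a = cong (vertexAt E) (sym (Finₚ.toℕ-cast (sym length≡4^n) a))

    cast-cast : ∀ t → cast (sym length≡4^n) (cast length≡4^n t) ≡ t
    cast-cast = Finₚ.cast-involutive (sym length≡4^n) length≡4^n

  at-injective : Injective _≡_ _≡_ at
  at-injective {a} {b} eq = Finₚ.toℕ-injective (begin
    toℕ a                          ≡⟨ Finₚ.toℕ-cast (sym length≡4^n) a ⟨
    toℕ (cast (sym length≡4^n) a)  ≡⟨ cong toℕ (walkPos-injective (trans (sym (at≡walkPos a)) (trans eq (at≡walkPos b)))) ⟩
    toℕ (cast (sym length≡4^n) b)  ≡⟨ Finₚ.toℕ-cast (sym length≡4^n) b ⟩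
    toℕ b                          ∎)
    where open ≡-Reasoning

  at-surjective : ∀ v → Σ (Fin (4 ^ n)) λ a → at a ≡ v
  at-surjective v with ∈ₚ.∈-tabulate⁻ (∈-walkPos v)
  ... | t , v≡ = cast length≡4^n t , trans (at≡walkPos _) (trans (cong walkPos (cast-cast t)) (sym v≡))

  at-zero : at (modN n 0) ≡ origin 1 n
  at-zero = cong (vertexAt E) (toℕ-modN-0 n)

  vertexAt-incZ : ∀ a → vertexAt E (suc (toℕ a)) ≡ at (incZ n a)
  vertexAt-incZ a with toℕ-incZ-cases n a
  ... | inj₁ a+1≡ = cong (vertexAt E) (sym a+1≡)
  ... | inj₂ (a+1≡0 , 1+a≡N) = begin
    vertexAt E (suc (toℕ a))   ≡⟨ cong (vertexAt E) (trans 1+a≡N (sym length≡4^n)) ⟩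
    vertexAt E (length E)      ≡⟨ cong (walkEnd o) (Lₚ.take-all (length E) E ℕₚ.≤-refl) ⟩
    walkEnd o E                ≡⟨ closed ⟩
    o                          ≡⟨⟩
    vertexAt E 0               ≡⟨ cong (vertexAt E) a+1≡0 ⟨
    at (incZ n a)              ∎
    where open ≡-Reasoning

  step-at : ∀ a → step (at a) (exit a) ≡ at (incZ n a)
  step-at a = begin
    step (at a) (exit a)                                 ≡⟨ cong (λ w → step w (exit a)) (at≡walkPos a) ⟩
    step (walkPos (cast (sym length≡4^n) a)) (exit a)    ≡⟨ walkEnd-take-suc o E (cast (sym length≡4^n) a) ⟨
    vertexAt E (suc (toℕ (cast (sym length≡4^n) a)))     ≡⟨ cong (vertexAt E ∘ suc) (Finₚ.toℕ-cast (sym length≡4^n) a) ⟩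
    vertexAt E (suc (toℕ a))                             ≡⟨ vertexAt-incZ a ⟩
    at (incZ n a)                                        ∎
    where open ≡-Reasoning

  private
    edgeAt≡edgePos : ∀ a → edgeAt a ≡ edgePos (cast (sym length≡4^n) a)
    edgeAt≡edgePos a = cong (λ w → edgeOf w (exit a)) (at≡walkPos a)

  edgeAt∈edges : ∀ a → edgeAt a ∈ edges 1 n E
  edgeAt∈edges a = subst₂ _∈_ (sym (edgeAt≡edgePos a)) (sym (edgesFrom≡tabulate o E)) (∈ₚ.∈-tabulate⁺ _)

  ∈edges⇒edgeAt : ∀ {e} → e ∈ edges 1 n E → Σ (Fin (4 ^ n)) λ a → edgeAt a ≡ e
  ∈edges⇒edgeAt e∈E with ∈ₚ.∈-tabulate⁻ (subst (_ ∈_) (edgesFrom≡tabulate o E) e∈E)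
  ... | t , e≡ = cast length≡4^n t , trans (edgeAt≡edgePos _) (trans (cong edgePos (cast-cast t)) (sym e≡))

  private
    -- E would run along one edge in both directions, giving a = b + 1 = a + 2.
    antiparallel : 1 ≤ n → ∀ {a b i} → exit a ≡ fwd i → exit b ≡ bwd i → at a ≡ step (at b) (bwd i) → ⊥
    antiparallel 1≤n {a} {b} {i} exit-a exit-b at-a = incZ-incZ≢id n 1≤n a (trans (cong (incZ n) a+1≡b) b+1≡a)
      where
      open ≡-Reasoning
      b+1≡a : incZ n b ≡ a
      b+1≡a = at-injective (begin
        at (incZ n b)           ≡⟨ step-at b ⟨
        step (at b) (exit b)    ≡⟨ cong (step (at b)) exit-b ⟩
        step (at b) (bwd i)     ≡⟨ at-a ⟨
        at a                    ∎)
      a+1≡b : incZ n a ≡ b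
      a+1≡b = at-injective (begin
        at (incZ n a)                       ≡⟨ step-at a ⟨
        step (at a) (exit a)                ≡⟨ cong (step (at a)) exit-a ⟩
        step (at a) (fwd i)                 ≡⟨ cong (λ w → step w (fwd i)) at-a ⟩
        step (step (at b) (bwd i)) (fwd i)  ≡⟨ step-opposite (at b) (bwd i) ⟩
        at b                                ∎)

  edgeAt-injective : 1 ≤ n → Injective _≡_ _≡_ edgeAt
  edgeAt-injective 1≤n {a} {b} eq with exit a in exit-a | exit b in exit-b
  ... | fwd i | fwd j = at-injective (cong proj₁ eq)
  ... | bwd i | bwd j with refl ← cong proj₂ eq = at-injective (step-injective (bwd i) (cong proj₁ eq))
  ... | fwd i | bwd j with refl ← cong proj₂ eq = ⊥-elim (antiparallel 1≤n exit-a exit-b (cong proj₁ eq))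
  ... | bwd i | fwd j with refl ← cong proj₂ eq = ⊥-elim (antiparallel 1≤n exit-b exit-a (sym (cong proj₁ eq)))

module Simulation {n k n' k' : ℕ}
  (g : Vertex n k → Vertex n' k') (L : Vertex n k → Label k → Label k')
  (step-g : ∀ x l → step (g x) (L x l) ≡ g (step x l)) where

  liftWalk : Vertex n k → Cycle k → Cycle k'
  liftWalk x []       = []
  liftWalk x (l ∷ ls) = L x l ∷ liftWalk (step x l) ls

  verts-liftWalk : ∀ x C → verts (g x) (liftWalk x C) ≡ map g (verts x C)
  verts-liftWalk x []       = refl
  verts-liftWalk x (l ∷ ls) rewrite step-g x l = cong (g x ∷_) (verts-liftWalk (step x l) ls)

  walkEnd-liftWalk : ∀ x C → walkEnd (g x) (liftWalk x C) ≡ g (walkEnd x C)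
  walkEnd-liftWalk x []       = refl
  walkEnd-liftWalk x (l ∷ ls) rewrite step-g x l = walkEnd-liftWalk (step x l) ls

  edgesFrom-liftWalk : (h : Edge n k → Edge n' k') → (∀ x l → edgeOf (g x) (L x l) ≡ h (edgeOf x l)) →
    ∀ x C → edgesFrom (g x) (liftWalk x C) ≡ map h (edgesFrom x C)
  edgesFrom-liftWalk h edgeOf-g x []       = refl
  edgesFrom-liftWalk h edgeOf-g x (l ∷ ls) rewrite step-g x l =
    cong₂ _∷_ (edgeOf-g x l) (edgesFrom-liftWalk h edgeOf-g (step x l) ls)

  liftWalk-isHamCycle : Injective _≡_ _≡_ g → (∀ w → Σ (Vertex n k) λ x → g x ≡ w) →
    g (origin n k) ≡ origin n' k' → ∀ C → IsHamCycle n k C → IsHamCycle n' k' (liftWalk (origin n k) C)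
  liftWalk-isHamCycle g-injective g-surjective g-origin C (closed , unique , complete)
    rewrite sym g-origin =
      trans (walkEnd-liftWalk o C) (cong g closed)
    , subst Unique (sym (verts-liftWalk o C)) (Uniqueₚ.map⁺ g-injective unique)
    , λ w → let (x , gx≡w) = g-surjective w in
        subst₂ _∈_ gx≡w (sym (verts-liftWalk o C)) (∈ₚ.∈-map⁺ g (complete x))
    where
    o : Vertex n k
    o = origin n k

pairs-map-trail : ∀ {n k} {B : Set} (g : Vertex n k → B) (x : Vertex n k) (l : Label k) (ls : Cycle k) →
  pairs (map g (trail x (l ∷ ls))) ≡ (g x , g (step x l)) ∷ pairs (map g (trail (step x l) ls))
pairs-map-trail g x l []       = refl
pairs-map-trail g x l (_ ∷ ls) = refl

replicate-++ : ∀ {A : Set} m n (x : A) → V.replicate m x V.++ V.replicate n x ≡ V.replicate (m + n) x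
replicate-++ zero    n x = refl
replicate-++ (suc m) n x = cong (x V.∷_) (replicate-++ m n x)

module Lift {n : ℕ} (E : Cycle n) (hE : IsHamCycle 1 n E) where

  open Enumeration E hE

  ψ : Vertex n 2 → Vertex 1 (n + n)
  ψ = ψinv E

  -- Leave position a along E, forwards or backwards according to l.
  exitToward : Label 2 → Fin (4 ^ n) → Label n
  exitToward (fwd _) a = exit a
  exitToward (bwd _) a = opposite (exit (decZ n a))

  edgeStart : Label 2 → Fin (4 ^ n) → Fin (4 ^ n)
  edgeStart (fwd _) a = a
  edgeStart (bwd _) a = decZ n a

  at≡step-at-decZ : ∀ a → at a ≡ step (at (decZ n a)) (exit (decZ n a))
  at≡step-at-decZ a = trans (cong at (sym (incZ-decZ n a))) (sym (step-at (decZ n a)))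

  step-exitToward : ∀ l a → step (at a) (exitToward l a) ≡ at (move n l a)
  step-exitToward (fwd _) a = step-at a
  step-exitToward (bwd _) a =
    trans (cong (λ w → step w (opposite (exit (decZ n a)))) (at≡step-at-decZ a)) (step-opposite _ _)

  edgeOf-exitToward : ∀ l a → edgeOf (at a) (exitToward l a) ≡ edgeAt (edgeStart l a)
  edgeOf-exitToward (fwd _) a = refl
  edgeOf-exitToward (bwd _) a =
    trans (cong (λ w → edgeOf w (opposite (exit (decZ n a)))) (at≡step-at-decZ a)) (edgeOf-opposite _ _)

  liftLabel : Vertex n 2 → Label 2 → Label (n + n)
  liftLabel (vtx (a V.∷ b V.∷ V.[])) l with axis l
  ... | Fin.zero          = mapAxis (_↑ˡ n) (exitToward l a)
  ... | Fin.suc Fin.zero  = mapAxis (n ↑ʳ_) (exitToward l b)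

  liftEdge : Edge n 2 → Edge 1 (n + n)
  liftEdge (vtx (a V.∷ b V.∷ V.[]) , Fin.zero)         = edgeˡ (edgeAt a) (at b)
  liftEdge (vtx (a V.∷ b V.∷ V.[]) , Fin.suc Fin.zero) = edgeʳ (at a) (edgeAt b)

  step-ψ : ∀ x l → step (ψ x) (liftLabel x l) ≡ ψ (step x l)
  step-ψ (vtx (a V.∷ b V.∷ V.[])) l@(fwd Fin.zero) =
    trans (step-++ᵥˡ (at a) (at b) _) (cong (_++ᵥ at b) (step-exitToward l a))
  step-ψ (vtx (a V.∷ b V.∷ V.[])) l@(bwd Fin.zero) =
    trans (step-++ᵥˡ (at a) (at b) _) (cong (_++ᵥ at b) (step-exitToward l a))
  step-ψ (vtx (a V.∷ b V.∷ V.[])) l@(fwd (Fin.suc Fin.zero)) =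
    trans (step-++ᵥʳ (at a) (at b) _) (cong (at a ++ᵥ_) (step-exitToward l b))
  step-ψ (vtx (a V.∷ b V.∷ V.[])) l@(bwd (Fin.suc Fin.zero)) =
    trans (step-++ᵥʳ (at a) (at b) _) (cong (at a ++ᵥ_) (step-exitToward l b))

  edgeOf-ψ : ∀ x l → edgeOf (ψ x) (liftLabel x l) ≡ liftEdge (edgeOf x l)
  edgeOf-ψ (vtx (a V.∷ b V.∷ V.[])) l@(fwd Fin.zero) =
    trans (edgeOf-++ᵥˡ (at a) (at b) _) (cong (λ e → edgeˡ e (at b)) (edgeOf-exitToward l a))
  edgeOf-ψ (vtx (a V.∷ b V.∷ V.[])) l@(bwd Fin.zero) =
    trans (edgeOf-++ᵥˡ (at a) (at b) _) (cong (λ e → edgeˡ e (at b)) (edgeOf-exitToward l a))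
  edgeOf-ψ (vtx (a V.∷ b V.∷ V.[])) l@(fwd (Fin.suc Fin.zero)) =
    trans (edgeOf-++ᵥʳ (at a) (at b) _) (cong (edgeʳ (at a)) (edgeOf-exitToward l b))
  edgeOf-ψ (vtx (a V.∷ b V.∷ V.[])) l@(bwd (Fin.suc Fin.zero)) =
    trans (edgeOf-++ᵥʳ (at a) (at b) _) (cong (edgeʳ (at a)) (edgeOf-exitToward l b))

  ψ-injective : Injective _≡_ _≡_ ψ
  ψ-injective {vtx (a V.∷ b V.∷ V.[])} {vtx (a' V.∷ b' V.∷ V.[])} eq
    with ++ᵥ-injective {u = at a} {at a'} {at b} {at b'} eq
  ... | at-a≡ , at-b≡ = cong₂ (λ a b → vtx (a V.∷ b V.∷ V.[])) (at-injective at-a≡) (at-injective at-b≡)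

  ψ-surjective : ∀ w → Σ (Vertex n 2) λ x → ψ x ≡ w
  ψ-surjective w with ++ᵥ-surjective {m = n} {n = n} w
  ... | u , v , refl with at-surjective u | at-surjective v
  ... | a , refl | b , refl = vtx (a V.∷ b V.∷ V.[]) , refl

  ψ-origin : ψ (origin n 2) ≡ origin 1 (n + n)
  ψ-origin = trans (cong₂ _++ᵥ_ at-zero at-zero) (cong vtx (replicate-++ n n _))

  open Simulation ψ liftLabel step-ψ public

  labelBetween-ψ : ∀ x l → labelBetween (ψ x) (ψ (step x l)) ≡ just (liftLabel x l)
  labelBetween-ψ x l = trans (cong (labelBetween (ψ x)) (sym (step-ψ x l))) (labelBetween-step (ψ x) (liftLabel x l))

  f≡liftWalk : ∀ H → f E H ≡ liftWalk (origin n 2) H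
  f≡liftWalk = go (origin n 2)
    where
    go : ∀ x H → L.mapMaybe (uncurry labelBetween) (pairs (map ψ (trail x H))) ≡ liftWalk x H
    go x []       = refl
    go x (l ∷ ls) rewrite pairs-map-trail ψ x l ls | labelBetween-ψ x l = cong (liftLabel x l ∷_) (go (step x l) ls)

  f-isHamCycle : ∀ H → IsHamCycle n 2 H → IsHamCycle 1 (n + n) (f E H)
  f-isHamCycle H hH = subst (IsHamCycle 1 (n + n)) (sym (f≡liftWalk H))
    (liftWalk-isHamCycle ψ-injective ψ-surjective ψ-origin H hH)

  edges-f : ∀ H → edges 1 (n + n) (f E H) ≡ map liftEdge (edges n 2 H)
  edges-f H = begin
    edgesFrom (origin 1 (n + n)) (f E H)                ≡⟨ cong₂ edgesFrom (sym ψ-origin) (f≡liftWalk H) ⟩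
    edgesFrom (ψ (origin n 2)) (liftWalk (origin n 2) H) ≡⟨ edgesFrom-liftWalk liftEdge edgeOf-ψ (origin n 2) H ⟩
    map liftEdge (edges n 2 H)                           ∎
    where open ≡-Reasoning

  shadow : Edge n 2 → Edge 1 n
  shadow (vtx (a V.∷ b V.∷ V.[]) , Fin.zero)         = edgeAt a
  shadow (vtx (a V.∷ b V.∷ V.[]) , Fin.suc Fin.zero) = edgeAt b

  shadow∈edges : ∀ g → shadow g ∈ edges 1 n E
  shadow∈edges (vtx (a V.∷ b V.∷ V.[]) , Fin.zero)         = edgeAt∈edges a
  shadow∈edges (vtx (a V.∷ b V.∷ V.[]) , Fin.suc Fin.zero) = edgeAt∈edges b

  project-liftEdge : ∀ g → project (liftEdge g) ≡ shadow g
  project-liftEdge (vtx (a V.∷ b V.∷ V.[]) , Fin.zero)         = project-edgeˡ (edgeAt a) (at b)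
  project-liftEdge (vtx (a V.∷ b V.∷ V.[]) , Fin.suc Fin.zero) = project-edgeʳ (at a) (edgeAt b)

  liftEdge-injective : 1 ≤ n → Injective _≡_ _≡_ liftEdge
  liftEdge-injective 1≤n {vtx (a V.∷ b V.∷ V.[]) , Fin.zero} {vtx (a' V.∷ b' V.∷ V.[]) , Fin.zero} eq
    with edgeˡ-injective {e = edgeAt a} {edgeAt a'} eq
  ... | edgeAt≡ , at≡ = cong₂ (λ a b → vtx (a V.∷ b V.∷ V.[]) , Fin.zero) (edgeAt-injective 1≤n edgeAt≡) (at-injective at≡)
  liftEdge-injective 1≤n {vtx (a V.∷ b V.∷ V.[]) , Fin.suc Fin.zero} {vtx (a' V.∷ b' V.∷ V.[]) , Fin.suc Fin.zero} eq
    with edgeʳ-injective {u = at a} {at a'} eq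
  ... | at≡ , edgeAt≡ = cong₂ (λ a b → vtx (a V.∷ b V.∷ V.[]) , Fin.suc Fin.zero) (at-injective at≡) (edgeAt-injective 1≤n edgeAt≡)
  liftEdge-injective 1≤n {vtx (a V.∷ b V.∷ V.[]) , Fin.zero} {vtx (a' V.∷ b' V.∷ V.[]) , Fin.suc Fin.zero} eq =
    ⊥-elim (edgeˡ≢edgeʳ (edgeAt a) (at b) (at a') (edgeAt b') eq)
  liftEdge-injective 1≤n {vtx (a V.∷ b V.∷ V.[]) , Fin.suc Fin.zero} {vtx (a' V.∷ b' V.∷ V.[]) , Fin.zero} eq =
    ⊥-elim (edgeˡ≢edgeʳ (edgeAt a') (at b') (at a) (edgeAt b) (sym eq))

  liftEdge-surjective : ∀ e → project e ∈ edges 1 n E → Σ (Edge n 2) λ g → liftEdge g ≡ e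
  liftEdge-surjective e e∈E with edge-split {m = n} {n = n} e
  ... | inj₁ (e' , v , refl) with ∈edges⇒edgeAt (subst (_∈ edges 1 n E) (project-edgeˡ e' v) e∈E) | at-surjective v
  ...   | a , refl | b , refl = (vtx (a V.∷ b V.∷ V.[]) , Fin.zero) , refl
  liftEdge-surjective e e∈E | inj₂ (u , e' , refl) with at-surjective u | ∈edges⇒edgeAt (subst (_∈ edges 1 n E) (project-edgeʳ u e') e∈E)
  ...   | a , refl | b , refl = (vtx (a V.∷ b V.∷ V.[]) , Fin.suc Fin.zero) , refl

axis-actL : ∀ {k} σ (l : Label k) → axis (actL σ l) ≡ σ ⟨$⟩ʳ axis l
axis-actL σ (fwd _) = refl
axis-actL σ (bwd _) = refl

move-actL : ∀ {n k} σ (l : Label k) → move n (actL σ l) ≡ move n l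
move-actL σ (fwd _) = refl
move-actL σ (bwd _) = refl

module _ {n k : ℕ} where

  vertex-ext : {w w' : Vertex n k} → (∀ j → coord w j ≡ coord w' j) → w ≡ w'
  vertex-ext {w} {w'} same = cong vtx (begin
    coords w                      ≡⟨ Vₚ.tabulate∘lookup (coords w) ⟨
    V.tabulate (coord w)          ≡⟨ Vₚ.tabulate-cong same ⟩
    V.tabulate (coord w')         ≡⟨ Vₚ.tabulate∘lookup (coords w') ⟩
    coords w'                     ∎)
    where open ≡-Reasoning

  permute : Permutation′ k → Vertex n k → Vertex n k
  permute σ w = vtx (V.tabulate (λ j → coord w (σ ⟨$⟩ˡ j)))

  coord-permute : ∀ σ w j → coord (permute σ w) j ≡ coord w (σ ⟨$⟩ˡ j)
  coord-permute σ w j = Vₚ.lookup∘tabulate _ j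

  permute-origin : ∀ σ → permute σ (origin n k) ≡ origin n k
  permute-origin σ = vertex-ext λ j → trans (coord-permute σ (origin n k) j)
    (trans (Vₚ.lookup-replicate (σ ⟨$⟩ˡ j) _) (sym (Vₚ.lookup-replicate j _)))

  permute-step : ∀ σ w (l : Label k) → permute σ (step w l) ≡ step (permute σ w) (actL σ l)
  permute-step σ w l = vertex-ext coord-≡
    where
    i = axis l
    coord-≡ : ∀ j → coord (permute σ (step w l)) j ≡ coord (step (permute σ w) (actL σ l)) j
    coord-≡ j with j Finₚ.≟ σ ⟨$⟩ʳ i
    ... | yes refl = begin
      coord (permute σ (step w l)) (σ ⟨$⟩ʳ i)            ≡⟨ coord-permute σ (step w l) _ ⟩
      coord (step w l) (σ ⟨$⟩ˡ (σ ⟨$⟩ʳ i))               ≡⟨ cong (coord (step w l)) (inverseˡ σ) ⟩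
      coord (step w l) i                                 ≡⟨ coord-step-axis w l ⟩
      move n l (coord w i)                               ≡⟨ cong (move n l ∘ coord w) (inverseˡ σ) ⟨
      move n l (coord w (σ ⟨$⟩ˡ (σ ⟨$⟩ʳ i)))            ≡⟨ cong₂ _$_ (move-actL σ l) (coord-permute σ w _) ⟨
      move n (actL σ l) (coord (permute σ w) (σ ⟨$⟩ʳ i)) ≡⟨ cong (λ i' → move n (actL σ l) (coord (permute σ w) i')) (axis-actL σ l) ⟨
      move n (actL σ l) (coord (permute σ w) (axis (actL σ l))) ≡⟨ coord-step-axis (permute σ w) (actL σ l) ⟨
      coord (step (permute σ w) (actL σ l)) (axis (actL σ l)) ≡⟨ cong (coord (step (permute σ w) (actL σ l))) (axis-actL σ l) ⟩
      coord (step (permute σ w) (actL σ l)) (σ ⟨$⟩ʳ i)  ∎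
      where open ≡-Reasoning
    ... | no j≢σi = begin
      coord (permute σ (step w l)) j                ≡⟨ coord-permute σ (step w l) j ⟩
      coord (step w l) (σ ⟨$⟩ˡ j)                   ≡⟨ coord-step-other w l (λ eq → j≢σi (trans (sym (inverseʳ σ)) (cong (σ ⟨$⟩ʳ_) eq))) ⟩
      coord w (σ ⟨$⟩ˡ j)                            ≡⟨ coord-permute σ w j ⟨
      coord (permute σ w) j                         ≡⟨ coord-step-other (permute σ w) (actL σ l) (λ eq → j≢σi (trans eq (axis-actL σ l))) ⟨
      coord (step (permute σ w) (actL σ l)) j       ∎
      where open ≡-Reasoning

  walkEnd-act : ∀ σ x (C : Cycle k) → walkEnd (permute σ x) (act σ C) ≡ permute σ (walkEnd x C)
  walkEnd-act σ x []      = refl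
  walkEnd-act σ x (l ∷ C) = trans (cong (λ y → walkEnd y (act σ C)) (sym (permute-step σ x l))) (walkEnd-act σ (step x l) C)

vertexAt-act : ∀ {k} σ (E : Cycle k) t → vertexAt (act σ E) t ≡ permute σ (vertexAt E t)
vertexAt-act {k} σ E t = begin
  walkEnd (origin 1 k) (take t (act σ E))              ≡⟨ cong (walkEnd (origin 1 k)) (Lₚ.take-map t E) ⟩
  walkEnd (origin 1 k) (act σ (take t E))              ≡⟨ cong (λ o → walkEnd o (act σ (take t E))) (permute-origin σ) ⟨
  walkEnd (permute σ (origin 1 k)) (act σ (take t E))  ≡⟨ walkEnd-act σ (origin 1 k) (take t E) ⟩
  permute σ (walkEnd (origin 1 k) (take t E))          ∎
  where open ≡-Reasoning

splitCopyAxis : ∀ n → Fin (n + n) → Fin 2 × Fin n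
splitCopyAxis n c = [ (Fin.zero ,_) , (Fin.suc Fin.zero ,_) ] (splitAt n c)

module _ {n : ℕ} where

  copyAxis : Fin 2 × Fin n → Fin (n + n)
  copyAxis (Fin.zero , i)          = i ↑ˡ n
  copyAxis (Fin.suc Fin.zero , i)  = n ↑ʳ i

  splitCopyAxis-copyAxis : ∀ p → splitCopyAxis n (copyAxis p) ≡ p
  splitCopyAxis-copyAxis (Fin.zero , i)         rewrite Finₚ.splitAt-↑ˡ n i n = refl
  splitCopyAxis-copyAxis (Fin.suc Fin.zero , i) rewrite Finₚ.splitAt-↑ʳ n n i = refl

  copyAxis-splitCopyAxis : ∀ c → copyAxis (splitCopyAxis n c) ≡ c
  copyAxis-splitCopyAxis c with splitAt n c in split-c
  ... | inj₁ i = trans (cong (Fin.join n n) (sym split-c)) (Finₚ.join-splitAt n n c)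
  ... | inj₂ i = trans (cong (Fin.join n n) (sym split-c)) (Finₚ.join-splitAt n n c)

  copyAxis-injective : Injective _≡_ _≡_ copyAxis
  copyAxis-injective {p} {q} eq =
    trans (sym (splitCopyAxis-copyAxis p)) (trans (cong (splitCopyAxis n) eq) (splitCopyAxis-copyAxis q))

  copyAxis-ext : ∀ {r} {w w' : Vertex r (n + n)} → (∀ p → coord w (copyAxis p) ≡ coord w' (copyAxis p)) → w ≡ w'
  copyAxis-ext {w = w} {w'} same = vertex-ext λ c →
    subst (λ c → coord w c ≡ coord w' c) (copyAxis-splitCopyAxis c) (same (splitCopyAxis n c))

  onCopies : (Fin 2 → Fin 2) → (Fin n → Fin n) → Fin (n + n) → Fin (n + n)
  onCopies p t = copyAxis ∘ Product.map p t ∘ splitCopyAxis n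

  onCopies-copyAxis : ∀ p t q → onCopies p t (copyAxis q) ≡ copyAxis (Product.map p t q)
  onCopies-copyAxis p t q = cong (copyAxis ∘ Product.map p t) (splitCopyAxis-copyAxis q)

  onCopies-inverse : ∀ p p' t t' → (∀ β → p (p' β) ≡ β) → (∀ i → t (t' i) ≡ i) →
    ∀ c → onCopies p t (onCopies p' t' c) ≡ c
  onCopies-inverse p p' t t' pp' tt' c = begin
    onCopies p t (copyAxis (Product.map p' t' (splitCopyAxis n c)))       ≡⟨ onCopies-copyAxis p t _ ⟩
    copyAxis (Product.map (p ∘ p') (t ∘ t') (splitCopyAxis n c))          ≡⟨ cong copyAxis (cong₂ _,_ (pp' _) (tt' _)) ⟩
    copyAxis (splitCopyAxis n c)                                          ≡⟨ copyAxis-splitCopyAxis c ⟩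
    c                                                                   ∎
    where open ≡-Reasoning

  _⊗_ : Permutation′ 2 → Permutation′ n → Permutation′ (n + n)
  π ⊗ τ = permutation (onCopies (π ⟨$⟩ʳ_) (τ ⟨$⟩ʳ_)) (onCopies (π ⟨$⟩ˡ_) (τ ⟨$⟩ˡ_))
    (onCopies-inverse (π ⟨$⟩ʳ_) (π ⟨$⟩ˡ_) (τ ⟨$⟩ʳ_) (τ ⟨$⟩ˡ_) (λ _ → inverseʳ π) (λ _ → inverseʳ τ))
    (onCopies-inverse (π ⟨$⟩ˡ_) (π ⟨$⟩ʳ_) (τ ⟨$⟩ˡ_) (τ ⟨$⟩ʳ_) (λ _ → inverseˡ π) (λ _ → inverseˡ τ))

  coord-ψinv : ∀ (E : Cycle n) x p →
    coord (ψinv E x) (copyAxis p) ≡ coord (vertexAt E (toℕ (coord x (proj₁ p)))) (proj₂ p)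
  coord-ψinv E (vtx (a V.∷ b V.∷ V.[])) (Fin.zero , i)         = Vₚ.lookup-++ˡ (coords (vertexAt E (toℕ a))) _ i
  coord-ψinv E (vtx (a V.∷ b V.∷ V.[])) (Fin.suc Fin.zero , i) = Vₚ.lookup-++ʳ (coords (vertexAt E (toℕ a))) _ i

  ψinv-act : ∀ π τ (E : Cycle n) x → ψinv (act τ E) (permute π x) ≡ permute (π ⊗ τ) (ψinv E x)
  ψinv-act π τ E x = copyAxis-ext same-coord
    where
    open ≡-Reasoning
    same-coord : ∀ p → coord (ψinv (act τ E) (permute π x)) (copyAxis p) ≡ coord (permute (π ⊗ τ) (ψinv E x)) (copyAxis p)
    same-coord (β , i) = begin
      coord (ψinv (act τ E) (permute π x)) (copyAxis (β , i))     ≡⟨ coord-ψinv (act τ E) (permute π x) (β , i) ⟩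
      coord (vertexAt (act τ E) (toℕ (coord (permute π x) β))) i ≡⟨ cong (λ a → coord (vertexAt (act τ E) (toℕ a)) i) (coord-permute π x β) ⟩
      coord (vertexAt (act τ E) t) i                              ≡⟨ cong (λ w → coord w i) (vertexAt-act τ E t) ⟩
      coord (permute τ (vertexAt E t)) i                          ≡⟨ coord-permute τ (vertexAt E t) i ⟩
      coord (vertexAt E t) (τ ⟨$⟩ˡ i)                             ≡⟨ coord-ψinv E x (π ⟨$⟩ˡ β , τ ⟨$⟩ˡ i) ⟨
      coord (ψinv E x) (copyAxis (π ⟨$⟩ˡ β , τ ⟨$⟩ˡ i))          ≡⟨ cong (coord (ψinv E x)) (onCopies-copyAxis (π ⟨$⟩ˡ_) (τ ⟨$⟩ˡ_) (β , i)) ⟨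
      coord (ψinv E x) ((π ⊗ τ) ⟨$⟩ˡ copyAxis (β , i))           ≡⟨ coord-permute (π ⊗ τ) (ψinv E x) (copyAxis (β , i)) ⟨
      coord (permute (π ⊗ τ) (ψinv E x)) (copyAxis (β , i))      ∎
      where
      t : ℕ
      t = toℕ (coord x (π ⟨$⟩ˡ β))

module _ {n : ℕ} (π : Permutation′ 2) (τ : Permutation′ n) {E : Cycle n}
         (hE : IsHamCycle 1 n E) (hτE : IsHamCycle 1 n (act τ E)) where

  private
    module A = Lift E hE
    module B = Lift (act τ E) hτE

    liftLabel-act : ∀ x l → B.liftLabel (permute π x) (actL π l) ≡ actL (π ⊗ τ) (A.liftLabel x l)
    liftLabel-act x l = step-injectiveʳ (B.ψ (permute π x)) (begin
      step (B.ψ (permute π x)) (B.liftLabel (permute π x) (actL π l))  ≡⟨ B.step-ψ (permute π x) (actL π l) ⟩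
      B.ψ (step (permute π x) (actL π l))                               ≡⟨ cong B.ψ (permute-step π x l) ⟨
      B.ψ (permute π (step x l))                                        ≡⟨ ψinv-act π τ E (step x l) ⟩
      permute (π ⊗ τ) (A.ψ (step x l))                                  ≡⟨ cong (permute (π ⊗ τ)) (A.step-ψ x l) ⟨
      permute (π ⊗ τ) (step (A.ψ x) (A.liftLabel x l))                  ≡⟨ permute-step (π ⊗ τ) (A.ψ x) (A.liftLabel x l) ⟩
      step (permute (π ⊗ τ) (A.ψ x)) (actL (π ⊗ τ) (A.liftLabel x l))   ≡⟨ cong (λ w → step w (actL (π ⊗ τ) (A.liftLabel x l))) (ψinv-act π τ E x) ⟨
      step (B.ψ (permute π x)) (actL (π ⊗ τ) (A.liftLabel x l))         ∎)
      where open ≡-Reasoning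

    liftWalk-act : ∀ x H → B.liftWalk (permute π x) (act π H) ≡ act (π ⊗ τ) (A.liftWalk x H)
    liftWalk-act x []       = refl
    liftWalk-act x (l ∷ ls) rewrite sym (permute-step π x l) = cong₂ _∷_ (liftLabel-act x l) (liftWalk-act (step x l) ls)

  f-act : ∀ H → f (act τ E) (act π H) ≡ act (π ⊗ τ) (f E H)
  f-act H = begin
    f (act τ E) (act π H)                                ≡⟨ B.f≡liftWalk (act π H) ⟩
    B.liftWalk (origin n 2) (act π H)                    ≡⟨ cong (λ o → B.liftWalk o (act π H)) (permute-origin π) ⟨
    B.liftWalk (permute π (origin n 2)) (act π H)        ≡⟨ liftWalk-act (origin n 2) H ⟩
    act (π ⊗ τ) (A.liftWalk (origin n 2) H)              ≡⟨ cong (act (π ⊗ τ)) (A.f≡liftWalk H) ⟨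
    act (π ⊗ τ) (f E H)                                  ∎
    where open ≡-Reasoning

IsHD-edge-unique : ∀ {n k} {T : Fin k → Cycle k} → IsHD n k T →
  ∀ {e a b} → e ∈ edges n k (T a) → e ∈ edges n k (T b) → a ≡ b
IsHD-edge-unique (_ , partition) {e} e∈Ta e∈Tb with partition e
... | c , _ , only-c = trans (only-c _ e∈Ta) (sym (only-c _ e∈Tb))

module _ {n : ℕ} (E : Fin n → Cycle n) (H : Fin 2 → Cycle 2) where

  fFamily-split : ∀ c → fFamily E H c ≡ f (E (proj₂ (splitCopyAxis n c))) (H (proj₁ (splitCopyAxis n c)))
  fFamily-split c with splitAt n c
  ... | inj₁ _ = refl
  ... | inj₂ _ = refl

  fFamily-copyAxis : ∀ p → fFamily E H (copyAxis p) ≡ f (E (proj₂ p)) (H (proj₁ p))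
  fFamily-copyAxis p = trans (fFamily-split (copyAxis p)) (cong (λ q → f (E (proj₂ q)) (H (proj₁ q))) (splitCopyAxis-copyAxis p))

module _ {n : ℕ} (1≤n : 1 ≤ n) {H : Fin 2 → Cycle 2} (hdH : IsHD n 2 H) {E : Fin n → Cycle n} (hdE : IsHD 1 n E) where

  private
    T : Fin (n + n) → Cycle (n + n)
    T = fFamily E H

    module Lₖ (k : Fin n) = Lift (E k) (proj₁ hdE k)

    edges-T : ∀ j k → edges 1 (n + n) (T (copyAxis (j , k))) ≡ map (Lₖ.liftEdge k) (edges n 2 (H j))
    edges-T j k = trans (cong (edges 1 (n + n)) (fFamily-copyAxis E H (j , k))) (Lₖ.edges-f k (H j))

    -- Projecting to the copy of Q_{2n} that contains it recovers an edge of E k, which pins down k.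
    lifts-unique : ∀ {j k j' k' g g'} → g ∈ edges n 2 (H j) → g' ∈ edges n 2 (H j') →
      Lₖ.liftEdge k g ≡ Lₖ.liftEdge k' g' → (j , k) ≡ (j' , k')
    lifts-unique {j} {k} {j'} {k'} {g} {g'} g∈Hj g'∈Hj' same-lift
      with IsHD-edge-unique hdE (Lₖ.shadow∈edges k g)
             (subst (_∈ edges 1 n (E k')) (trans (sym (Lₖ.project-liftEdge k' g')) (trans (cong project (sym same-lift)) (Lₖ.project-liftEdge k g)))
               (Lₖ.shadow∈edges k' g'))
    ... | refl with Lₖ.liftEdge-injective k 1≤n same-lift
    ...   | refl = cong (_, k) (IsHD-edge-unique hdH g∈Hj g'∈Hj')

    ∈T-copyAxis : ∀ {e} j k → e ∈ edges 1 (n + n) (T (copyAxis (j , k))) →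
      Σ (Edge n 2) λ g → g ∈ edges n 2 (H j) × e ≡ Lₖ.liftEdge k g
    ∈T-copyAxis j k e∈T = ∈ₚ.∈-map⁻ (Lₖ.liftEdge k) (subst (_ ∈_) (edges-T j k) e∈T)

    ∈T-unique : ∀ {e} c j k g → g ∈ edges n 2 (H j) → e ≡ Lₖ.liftEdge k g → e ∈ edges 1 (n + n) (T c) → c ≡ copyAxis (j , k)
    ∈T-unique {e} c j k g g∈Hj e≡ e∈Tc
      with ∈T-copyAxis (proj₁ (splitCopyAxis n c)) (proj₂ (splitCopyAxis n c))
             (subst (λ c → e ∈ edges 1 (n + n) (T c)) (sym (copyAxis-splitCopyAxis {n} c)) e∈Tc)
    ... | g' , g'∈ , e≡' = trans (sym (copyAxis-splitCopyAxis {n} c)) (cong copyAxis (lifts-unique g'∈ g∈Hj (trans (sym e≡') e≡)))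

  fFamily-isHD : IsHD 1 (n + n) (fFamily E H)
  fFamily-isHD = isHam , partition
    where
    isHam : ∀ c → IsHamCycle 1 (n + n) (T c)
    isHam c = subst (IsHamCycle 1 (n + n)) (sym (fFamily-split E H c))
      (Lₖ.f-isHamCycle (proj₂ (splitCopyAxis n c)) _ (proj₁ hdH (proj₁ (splitCopyAxis n c))))
    partition : ∀ e → Σ (Fin (n + n)) λ c → e ∈ edges 1 (n + n) (T c) × (∀ c' → e ∈ edges 1 (n + n) (T c') → c' ≡ c)
    partition e with proj₂ hdE (project e)
    ... | k , e∈Ek , _ with Lₖ.liftEdge-surjective k e e∈Ek
    ...   | g , refl with proj₂ hdH g
    ...     | j , g∈Hj , _ = copyAxis (j , k)
                           , subst (_ ∈_) (sym (edges-T j k)) (∈ₚ.∈-map⁺ (Lₖ.liftEdge k) g∈Hj)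
                           , λ c' e∈Tc' → ∈T-unique c' j k g g∈Hj refl e∈Tc'

module _ {n : ℕ} (π : Fin 2 → Permutation′ 2) (τ : Fin n → Permutation′ n) where

  productFamily : Fin (n + n) → Permutation′ (n + n)
  productFamily a = π (proj₁ (splitCopyAxis n a)) ⊗ τ (proj₂ (splitCopyAxis n a))

  productFamily-copyAxis : ∀ j k → productFamily (copyAxis (j , k)) ≡ π j ⊗ τ k
  productFamily-copyAxis j k = cong (λ q → π (proj₁ q) ⊗ τ (proj₂ q)) (splitCopyAxis-copyAxis (j , k))

  productFamily-isLatin : IsLatinFamily 2 π → IsLatinFamily n τ → IsLatinFamily (n + n) productFamily
  productFamily-isLatin ((j₀ , π-id) , π-injective , π-surjective) ((k₀ , τ-id) , τ-injective , τ-surjective) =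
    (copyAxis (j₀ , k₀) , has-id) , injective , surjective
    where
    open ≡-Reasoning
    split = splitCopyAxis n
    has-id : ∀ c → productFamily (copyAxis (j₀ , k₀)) ⟨$⟩ʳ c ≡ c
    has-id c = begin
      productFamily (copyAxis (j₀ , k₀)) ⟨$⟩ʳ c                              ≡⟨ cong (_⟨$⟩ʳ c) (productFamily-copyAxis j₀ k₀) ⟩
      copyAxis (π j₀ ⟨$⟩ʳ proj₁ (split c) , τ k₀ ⟨$⟩ʳ proj₂ (split c))       ≡⟨ cong copyAxis (cong₂ _,_ (π-id _) (τ-id _)) ⟩
      copyAxis (split c)                                                     ≡⟨ copyAxis-splitCopyAxis {n} c ⟩
      c                                                                      ∎
    injective : ∀ c → Injective _≡_ _≡_ (λ a → productFamily a ⟨$⟩ʳ c)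
    injective c {a} {a'} eq = begin
      a                      ≡⟨ copyAxis-splitCopyAxis {n} a ⟨
      copyAxis (split a)     ≡⟨ cong copyAxis (cong₂ _,_ (π-injective _ (cong proj₁ same)) (τ-injective _ (cong proj₂ same))) ⟩
      copyAxis (split a')    ≡⟨ copyAxis-splitCopyAxis {n} a' ⟩
      a'                     ∎
      where
      same : (π (proj₁ (split a)) ⟨$⟩ʳ proj₁ (split c) , τ (proj₂ (split a)) ⟨$⟩ʳ proj₂ (split c))
           ≡ (π (proj₁ (split a')) ⟨$⟩ʳ proj₁ (split c) , τ (proj₂ (split a')) ⟨$⟩ʳ proj₂ (split c))
      same = copyAxis-injective eq
    surjective : ∀ c s → Σ (Fin (n + n)) λ a → productFamily a ⟨$⟩ʳ c ≡ s
    surjective c s with π-surjective (proj₁ (split c)) (proj₁ (split s)) | τ-surjective (proj₂ (split c)) (proj₂ (split s))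
    ... | j , πj≡ | k , τk≡ = copyAxis (j , k) , (begin
      productFamily (copyAxis (j , k)) ⟨$⟩ʳ c                            ≡⟨ cong (_⟨$⟩ʳ c) (productFamily-copyAxis j k) ⟩
      copyAxis (π j ⟨$⟩ʳ proj₁ (split c) , τ k ⟨$⟩ʳ proj₂ (split c))     ≡⟨ cong copyAxis (cong₂ _,_ πj≡ τk≡) ⟩
      copyAxis (split s)                                                 ≡⟨ copyAxis-splitCopyAxis {n} s ⟩
      s                                                                  ∎)

fFamily-isLatin : ∀ {n} {H : Fin 2 → Cycle 2} {E : Fin n → Cycle n} → (∀ k → IsHamCycle 1 n (E k)) →
  IsLatin n 2 H → IsLatin 1 n E → IsLatin 1 (n + n) (fFamily E H)
fFamily-isLatin {n} {H} {E} hamE (H₀ , hH₀ , π , π-latin , H-in , in-H) (E₀ , hE₀ , τ , τ-latin , E-in , in-E) =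
  f E₀ H₀ , Lift.f-isHamCycle E₀ hE₀ H₀ hH₀ , productFamily π τ , productFamily-isLatin π τ π-latin τ-latin , T-in , in-T
  where
  open ≡-Reasoning
  split = splitCopyAxis n

  -- The hypothesis only serves to make τ k E₀ Hamiltonian.
  f-act-of : ∀ j k m → act (τ k) E₀ ≡ E m → f (act (τ k) E₀) (act (π j) H₀) ≡ act (productFamily π τ (copyAxis (j , k))) (f E₀ H₀)
  f-act-of j k m τE₀≡ = trans (f-act (π j) (τ k) hE₀ (subst (IsHamCycle 1 n) (sym τE₀≡) (hamE m)) H₀)
    (cong (λ σ → act σ (f E₀ H₀)) (sym (productFamily-copyAxis π τ j k)))

  T-in : ∀ a → Σ (Fin (n + n)) λ b → fFamily E H a ≡ act (productFamily π τ b) (f E₀ H₀)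
  T-in a with H-in (proj₁ (split a)) | E-in (proj₂ (split a))
  ... | j , H≡ | k , E≡ = copyAxis (j , k) , (begin
    fFamily E H a                                  ≡⟨ fFamily-split E H a ⟩
    f (E (proj₂ (split a))) (H (proj₁ (split a)))  ≡⟨ cong₂ f E≡ H≡ ⟩
    f (act (τ k) E₀) (act (π j) H₀)                ≡⟨ f-act-of j k (proj₂ (split a)) (sym E≡) ⟩
    act (productFamily π τ (copyAxis (j , k))) (f E₀ H₀) ∎)

  in-T : ∀ b → Σ (Fin (n + n)) λ a → act (productFamily π τ b) (f E₀ H₀) ≡ fFamily E H a
  in-T b with in-H (proj₁ (split b)) | in-E (proj₂ (split b))
  ... | j , ≡H | k , ≡E = copyAxis (j , k) , (begin
    act (productFamily π τ b) (f E₀ H₀)                                       ≡⟨ cong (λ b → act (productFamily π τ b) (f E₀ H₀)) (copyAxis-splitCopyAxis {n} b) ⟨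
    act (productFamily π τ (copyAxis (split b))) (f E₀ H₀)                    ≡⟨ f-act-of (proj₁ (split b)) (proj₂ (split b)) k ≡E ⟨
    f (act (τ (proj₂ (split b))) E₀) (act (π (proj₁ (split b))) H₀)          ≡⟨ cong₂ f ≡E ≡H ⟩
    f (E k) (H j)                                                             ≡⟨ fFamily-copyAxis E H (j , k) ⟨
    fFamily E H (copyAxis (j , k))                                            ∎)

theorem2 : (n : ℕ) → 1 ≤ n →
    (H : Fin 2 → Cycle 2) → IsLatinHD n 2 H →
    (E : Fin n → Cycle n) → IsLatinHD 1 n E →
    IsLatinHD 1 (n + n) (fFamily E H)
theorem2 n 1≤n H (hdH , latinH) E (hdE , latinE) =
  fFamily-isHD 1≤n hdH hdE , fFamily-isLatin (proj₁ hdE) latinH latinE
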